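{- Let $X_1,\ldots,X_n$ be independent random variables with two-point distributions, $X_j$ taking values $a_j\le b_j$. For each $i=1,\ldots,n$, let $\sigma^i$ be any ordering whose last variable is $X_i$ and in which the remaining $n-1$ variables are arranged in weakly descending order of their right endpoints $b_j$. Then at least one of the orderings $\sigma^1,\ldots,\sigma^n$ is optimal, i.e. maximizes $V_\sigma$ over all permutations $\sigma$.
   Context: A two-point distribution for $X_j$: $X_j=a_j$ with probability $1-p_j$ and $X_j=b_j$ with probability $p_j$, where $a_j\le b_j$. For a permutation $\sigma$, the player observes $X_{\sigma(1)},X_{\sigma(2)},\ldots$ in order and may stop after each observation receiving the observed value, receiving $0$ if she never stops. $V_\sigma(n+1)=0$, $V_\sigma(j)=E[\max(X_{\sigma(j)},V_\sigma(j+1))]$, $V_\sigma:=V_\sigma(1)$.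
   Formalization: The values $a_j\le b_j$ of the two-point distributions and their probabilities $p_j$ are rational. -}

module Defs where

open import Data.Nat using (ℕ; suc)
open import Data.Fin using (Fin)
open import Data.List using (List; foldr; map; allFin)
open import Data.Rational using (ℚ; 0ℚ; 1ℚ; _+_; _*_; _-_; _⊔_)
open import Data.Fin.Permutation using (Permutation′; _⟨$⟩ʳ_)

-- One backward-induction step: E[max(X_j , v)] for the two-point X_j
-- (X_j = a j w.p. 1 - p j, X_j = b j w.p. p j).
step : {n : ℕ} (a b p : Fin n → ℚ) → Fin n → ℚ → ℚ
step a b p j v = (1ℚ - p j) * (a j ⊔ v) + p j * (b j ⊔ v)

-- V_σ = V_σ(1), computed by V_σ(n+1) = 0, V_σ(k) = E[max(X_{σ(k)}, V_σ(k+1))].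
-- Position k of the ordering is observed variable σ(k) = σ ⟨$⟩ʳ k.
V : {n : ℕ} (a b p : Fin n → ℚ) → Permutation′ n → ℚ
V {n} a b p σ = foldr (step a b p) 0ℚ (map (σ ⟨$⟩ʳ_) (allFin n))

{-# OPTIONS --safe #-}
-- Let step⁻ j w = max (w , (1 - p j) w + p j b j) be the value of observing X_j with continuation
-- value w when X_j may only be accepted at its high value b j. Then step⁻ j ≤ step j, with
-- equality once w ≥ a j; each step⁻ j is monotone and inflationary, and
-- step⁻ i ∘ step⁻ j ≤ step⁻ j ∘ step⁻ i whenever b i ≤ b j. So composing the step⁻ over distinct
-- indices is dominated by composing them over any superset listed in descending order of b.
-- Run through an ordering σ from the front, trading step for step⁻ while the continuation value
-- is at least a j. At the first X_x whose continuation value is below a x (or at the last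
-- variable) X_x is accepted whatever its value, so its continuation may be replaced by 0, and
-- the variables passed so far are dominated by the others in descending order: V σ ≤ V σ^x.
module Submission where

open import Defs
open import Data.Nat using (ℕ; suc)
open import Data.Nat as N using ()
open import Data.Fin using (Fin; toℕ; fromℕ)
open import Data.Product using (Σ)
open import Data.Rational using (ℚ; 0ℚ; 1ℚ; _≤_)
open import Relation.Binary.PropositionalEquality using (_≡_)
open import Data.Fin.Permutation using (Permutation′; _⟨$⟩ʳ_)

open import Data.Fin using (zero; suc; inject₁)
open import Data.Fin.Properties using (toℕ-inject₁; toℕ<n)
open import Data.Fin.Permutation using (_⟨$⟩ˡ_; inverseʳ)
open import Data.Product using (_,_)
open import Data.Sum using (inj₁; inj₂)
open import Data.Rational using (_+_; _*_; _-_; _⊔_; -_; nonNegative)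
open import Data.Rational.Properties
open import Data.Rational.Solver using (module +-*-Solver)
open import Relation.Binary.PropositionalEquality using (refl; sym; trans; cong; cong₂; subst; subst₂; _≢_; setoid)
open import Data.List using (List; []; _∷_; _++_; _∷ʳ_; foldr; map; allFin; tabulate; [_])
open import Function using (_∘_; id; Injection)
open import Function.Properties.Inverse using (↔⇒↣)
open import Data.List.Properties using (foldr-++; foldr-∷ʳ; ++-assoc; map-tabulate)
open import Relation.Binary.Bundles using (DecTotalOrder)
open import Data.List.Extrema (DecTotalOrder.totalOrder ≤-decTotalOrder) using (argmax; f[xs]≤f[argmax])
open import Data.List.Membership.Propositional using (_∈_)
open import Data.List.Membership.Propositional.Properties using (∈-∃++; ∈-++⁻; ∈-++⁺ˡ; ∈-map⁺; ∈-allFin)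
open import Data.List.Relation.Unary.Any using (here; there)
open import Data.List.Relation.Unary.All as All using (All; []; _∷_)
open import Data.List.Relation.Unary.All.Properties using (++⁻ˡ)
open import Data.List.Relation.Unary.AllPairs as AllPairs using (AllPairs; []; _∷_)
open import Data.List.Relation.Unary.AllPairs.Properties using (tabulate⁺-<)
open import Data.List.Relation.Unary.Unique.Propositional using (Unique)
open import Data.List.Relation.Unary.Unique.Propositional.Properties using (map⁺; allFin⁺)
open import Data.List.Relation.Binary.Subset.Propositional using (_⊆_)
open import Data.List.Relation.Binary.Subset.Propositional.Properties using (⊆∷⇒∈∨⊆; ⊆∷∧∉⇒⊆; ∷⊈[]; xs⊆x∷xs; ++⁺ʳ)
open import Data.Empty using (⊥-elim)
import Data.List.Relation.Binary.Permutation.Setoid.Properties as PermutationProperties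

p≤q⇒0≤q-p : ∀ {p q} → p ≤ q → 0ℚ ≤ q - p
p≤q⇒0≤q-p {p} {q} p≤q = begin
  0ℚ    ≡⟨ sym (+-inverseʳ p) ⟩
  p - p ≤⟨ +-monoˡ-≤ (- p) p≤q ⟩
  q - p ∎
  where open ≤-Reasoning

*-monoˡ-≤-0≤ : ∀ {r u v} → 0ℚ ≤ r → u ≤ v → r * u ≤ r * v
*-monoˡ-≤-0≤ {r} 0≤r = *-monoˡ-≤-nonNeg r {{nonNegative 0≤r}}

0≤p⇒0≤q⇒0≤p*q : ∀ {p q} → 0ℚ ≤ p → 0ℚ ≤ q → 0ℚ ≤ p * q
0≤p⇒0≤q⇒0≤p*q {p} {q} 0≤p 0≤q = nonNegative⁻¹ (p * q) {{nonNeg*nonNeg⇒nonNeg p {{nonNegative 0≤p}} q {{nonNegative 0≤q}}}}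

Descending : {A : Set} → (A → ℚ) → List A → Set
Descending key = AllPairs (λ x y → key y ≤ key x)

Unique-++⁻ˡ : {A : Set} (xs : List A) {ys : List A} → Unique (xs ++ ys) → Unique xs
Unique-++⁻ˡ []       _           = []
Unique-++⁻ˡ (x ∷ xs) (x∉ ∷ xs++!) = ++⁻ˡ xs x∉ ∷ Unique-++⁻ˡ xs xs++!

Unique-shift : {A : Set} (xs : List A) {y : A} {ys : List A} → Unique (xs ++ y ∷ ys) → Unique (y ∷ xs ++ ys)
Unique-shift {A} xs {ys = ys} = Unique-resp-↭ (↭-shift xs ys)
  where open PermutationProperties (setoid A) using (Unique-resp-↭; ↭-shift)

module Reordering {A : Set} (key : A → ℚ) (g : A → ℚ → ℚ)
  (g-mono : ∀ x {u v} → u ≤ v → g x u ≤ g x v)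
  (g-inflationary : ∀ x u → u ≤ g x u)
  (g-swap : ∀ x y u → key x ≤ key y → g x (g y u) ≤ g y (g x u)) where

  foldr-mono : ∀ xs {u v} → u ≤ v → foldr g u xs ≤ foldr g v xs
  foldr-mono []       u≤v = u≤v
  foldr-mono (x ∷ xs) u≤v = g-mono x (foldr-mono xs u≤v)

  foldr-pull : ∀ {y} xs u → All (λ x → key x ≤ key y) xs → foldr g (g y u) xs ≤ g y (foldr g u xs)
  foldr-pull []       u []             = ≤-refl
  foldr-pull {y} (x ∷ xs) u (x≤y ∷ xs≤y) = ≤-trans (g-mono x (foldr-pull xs u xs≤y)) (g-swap x y (foldr g u xs) x≤y)

  foldr-⊆-descending : ∀ {xs} ys → Descending key ys → Unique xs → xs ⊆ ys → ∀ u → foldr g u xs ≤ foldr g u ys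
  foldr-⊆-descending {[]}    []       _ _ _     u = ≤-refl
  foldr-⊆-descending {_ ∷ _} []       _ _ xs⊆[] u = ⊥-elim (∷⊈[] xs⊆[])
  foldr-⊆-descending {xs} (y ∷ ys) (ys≤y ∷ ys↓) xs! xs⊆y∷ys u with ⊆∷⇒∈∨⊆ xs⊆y∷ys
  ... | inj₂ xs⊆ys = ≤-trans (foldr-⊆-descending ys ys↓ xs! xs⊆ys u) (g-inflationary y (foldr g u ys))
  ... | inj₁ y∈xs with ∈-∃++ y∈xs
  ... | l , r , refl = begin
    foldr g u (l ++ y ∷ r)          ≡⟨ foldr-++ g u l (y ∷ r) ⟩
    foldr g (g y (foldr g u r)) l   ≤⟨ foldr-pull l (foldr g u r) (All.tabulate l≤y) ⟩
    g y (foldr g (foldr g u r) l)   ≡⟨ cong (g y) (foldr-++ g u l r) ⟨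
    g y (foldr g u (l ++ r))        ≤⟨ g-mono y (foldr-⊆-descending ys ys↓ l++r! l++r⊆ys u) ⟩
    g y (foldr g u ys)              ∎
    where
    open ≤-Reasoning
    y∷l++r! : Unique (y ∷ l ++ r)
    y∷l++r! = Unique-shift l xs!
    l++r! : Unique (l ++ r)
    l++r! = AllPairs.tail y∷l++r!
    l++r⊆ys : l ++ r ⊆ ys
    l++r⊆ys = ⊆∷∧∉⇒⊆ (λ z∈ → xs⊆y∷ys (++⁺ʳ l (xs⊆x∷xs r y) z∈)) (λ y∈ → All.lookup (AllPairs.head y∷l++r!) y∈ refl)
    l≤y : ∀ {x} → x ∈ l → key x ≤ key y
    l≤y x∈l with xs⊆y∷ys (∈-++⁺ˡ x∈l)
    ... | here refl = ≤-refl
    ... | there x∈ys = All.lookup ys≤y x∈ys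

module TwoPoint {n : ℕ} (a b p : Fin n → ℚ)
  (a≤b : ∀ j → a j ≤ b j) (0≤p : ∀ j → 0ℚ ≤ p j) (p≤1 : ∀ j → p j ≤ 1ℚ) where

  0≤1-p : ∀ j → 0ℚ ≤ 1ℚ - p j
  0≤1-p j = p≤q⇒0≤q-p (p≤1 j)

  mixture : Fin n → ℚ → ℚ → ℚ
  mixture j low high = (1ℚ - p j) * low + p j * high

  mixture-mono : ∀ j {u u′ v v′} → u ≤ u′ → v ≤ v′ → mixture j u v ≤ mixture j u′ v′
  mixture-mono j u≤u′ v≤v′ = +-mono-≤ (*-monoˡ-≤-0≤ (0≤1-p j) u≤u′) (*-monoˡ-≤-0≤ (0≤p j) v≤v′)

  mixture-diag : ∀ j w → mixture j w w ≡ w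
  mixture-diag j w = solve 2 (λ r w → (con 1ℚ :- r) :* w :+ r :* w := w) refl (p j) w
    where open +-*-Solver

  acceptHigh : Fin n → ℚ → ℚ
  acceptHigh j w = mixture j w (b j)

  step⁻ : Fin n → ℚ → ℚ
  step⁻ j w = w ⊔ acceptHigh j w

  step-mono : ∀ j {u v} → u ≤ v → step a b p j u ≤ step a b p j v
  step-mono j u≤v = mixture-mono j (⊔-monoʳ-≤ (a j) u≤v) (⊔-monoʳ-≤ (b j) u≤v)

  step≤step-0 : ∀ j {w} → w ≤ a j → step a b p j w ≤ step a b p j 0ℚ
  step≤step-0 j {w} w≤a = mixture-mono j (absorb w≤a) (absorb (≤-trans w≤a (a≤b j)))
    where
    absorb : ∀ {c} → w ≤ c → c ⊔ w ≤ c ⊔ 0ℚ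
    absorb {c} w≤c = ⊔-lub (p≤p⊔q c 0ℚ) (≤-trans w≤c (p≤p⊔q c 0ℚ))

  step⁻≤step : ∀ j w → step⁻ j w ≤ step a b p j w
  step⁻≤step j w = ⊔-lub
    (≤-trans (≤-reflexive (sym (mixture-diag j w))) (mixture-mono j (p≤q⊔p (a j) w) (p≤q⊔p (b j) w)))
    (mixture-mono j (p≤q⊔p (a j) w) (p≤p⊔q (b j) w))

  step≤step⁻ : ∀ j {w} → a j ≤ w → step a b p j w ≤ step⁻ j w
  step≤step⁻ j {w} a≤w with ≤-total (b j) w
  ... | inj₁ b≤w = begin
    mixture j (a j ⊔ w) (b j ⊔ w) ≡⟨ cong₂ (mixture j) (p≤q⇒p⊔q≡q a≤w) (p≤q⇒p⊔q≡q b≤w) ⟩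
    mixture j w w                 ≡⟨ mixture-diag j w ⟩
    w                             ≤⟨ p≤p⊔q w (acceptHigh j w) ⟩
    step⁻ j w                     ∎
    where open ≤-Reasoning
  ... | inj₂ w≤b = begin
    mixture j (a j ⊔ w) (b j ⊔ w) ≡⟨ cong₂ (mixture j) (p≤q⇒p⊔q≡q a≤w) (p≥q⇒p⊔q≡p w≤b) ⟩
    acceptHigh j w                ≤⟨ p≤q⊔p w (acceptHigh j w) ⟩
    step⁻ j w                     ∎
    where open ≤-Reasoning

  acceptHigh-mono : ∀ j {u v} → u ≤ v → acceptHigh j u ≤ acceptHigh j v
  acceptHigh-mono j u≤v = mixture-mono j u≤v ≤-refl

  step⁻-mono : ∀ j {u v} → u ≤ v → step⁻ j u ≤ step⁻ j v
  step⁻-mono j u≤v = ⊔-mono-≤ u≤v (acceptHigh-mono j u≤v)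

  step⁻-inflationary : ∀ j w → w ≤ step⁻ j w
  step⁻-inflationary j w = p≤p⊔q w (acceptHigh j w)

  acceptHigh-swap : ∀ i j u → b i ≤ b j → acceptHigh i (acceptHigh j u) ≤ acceptHigh j (acceptHigh i u)
  acceptHigh-swap i j u bi≤bj = begin
    acceptHigh i (acceptHigh j u)                              ≡⟨ +-identityʳ _ ⟨
    acceptHigh i (acceptHigh j u) + 0ℚ                         ≤⟨ +-monoʳ-≤ (acceptHigh i (acceptHigh j u)) 0≤defect ⟩
    acceptHigh i (acceptHigh j u) + p j * p i * (b j - b i)    ≡⟨ swap-defect u (p i) (p j) (b i) (b j) ⟩
    acceptHigh j (acceptHigh i u)                              ∎
    where
    open ≤-Reasoning
    0≤defect : 0ℚ ≤ p j * p i * (b j - b i)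
    0≤defect = 0≤p⇒0≤q⇒0≤p*q (0≤p⇒0≤q⇒0≤p*q (0≤p j) (0≤p i)) (p≤q⇒0≤q-p bi≤bj)
    open +-*-Solver
    swap-defect : ∀ u r s c d → (1ℚ - r) * ((1ℚ - s) * u + s * d) + r * c + s * r * (d - c)
                              ≡ (1ℚ - s) * ((1ℚ - r) * u + r * c) + s * d
    swap-defect = solve 5 (λ u r s c d → (con 1ℚ :- r) :* ((con 1ℚ :- s) :* u :+ s :* d) :+ r :* c :+ s :* r :* (d :- c)
                                       := (con 1ℚ :- s) :* ((con 1ℚ :- r) :* u :+ r :* c) :+ s :* d) refl

  step⁻-swap : ∀ i j u → b i ≤ b j → step⁻ i (step⁻ j u) ≤ step⁻ j (step⁻ i u)
  step⁻-swap i j u bi≤bj = ⊔-lub (step⁻-mono j (step⁻-inflationary i u)) (begin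
    acceptHigh i (u ⊔ acceptHigh j u)                ≡⟨ mono-≤-distrib-⊔ (acceptHigh-mono i) u (acceptHigh j u) ⟩
    acceptHigh i u ⊔ acceptHigh i (acceptHigh j u)   ≤⟨ ⊔-mono-≤ (p≤q⊔p u (acceptHigh i u)) (acceptHigh-swap i j u bi≤bj) ⟩
    step⁻ i u ⊔ acceptHigh j (acceptHigh i u)        ≤⟨ ⊔-monoʳ-≤ (step⁻ i u) (acceptHigh-mono j (p≤q⊔p u (acceptHigh i u))) ⟩
    step⁻ j (step⁻ i u)                              ∎)
    where open ≤-Reasoning

  open Reordering b step⁻ step⁻-mono step⁻-inflationary step⁻-swap

  foldr-step⁻≤foldr-step : ∀ xs u → foldr step⁻ u xs ≤ foldr (step a b p) u xs
  foldr-step⁻≤foldr-step []       u = ≤-refl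
  foldr-step⁻≤foldr-step (x ∷ xs) u = ≤-trans (step⁻≤step x (foldr step⁻ u xs)) (step-mono x (foldr-step⁻≤foldr-step xs u))

  module Walk (others : Fin n → List (Fin n))
    (others-descending : ∀ x → Descending b (others x))
    (others-complete : ∀ x {z} → z ≢ x → z ∈ others x) where

    candidate : Fin n → ℚ
    candidate x = foldr (step a b p) (step a b p x 0ℚ) (others x)

    foldr-step⁻≤candidate : ∀ P x {L} → Unique (P ++ x ∷ L) → foldr step⁻ (step a b p x 0ℚ) P ≤ candidate x
    foldr-step⁻≤candidate P x P++x∷L! = ≤-trans
      (foldr-⊆-descending (others x) (others-descending x) (Unique-++⁻ˡ P P++x∷L!) P⊆others _)
      (foldr-step⁻≤foldr-step (others x) _)
      where
      P⊆others : P ⊆ others x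
      P⊆others z∈P = others-complete x λ { refl → All.lookup (AllPairs.head (Unique-shift P P++x∷L!)) (∈-++⁺ˡ z∈P) refl }

    walk : ∀ P x L → Unique (P ++ x ∷ L) → Σ (Fin n) λ i → foldr step⁻ (foldr (step a b p) 0ℚ (x ∷ L)) P ≤ candidate i
    walk P x []      P++x! = x , foldr-step⁻≤candidate P x P++x!
    walk P x (y ∷ L) P++x∷y∷L! with ≤-total (foldr (step a b p) 0ℚ (y ∷ L)) (a x)
    ... | inj₁ w≤a = x , ≤-trans (foldr-mono P (step≤step-0 x w≤a)) (foldr-step⁻≤candidate P x P++x∷y∷L!)
    ... | inj₂ a≤w with walk (P ++ [ x ]) y L (subst Unique (sym (++-assoc P [ x ] (y ∷ L))) P++x∷y∷L!)
    ... | i , bound = i , (begin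
      foldr step⁻ (step a b p x w) P    ≤⟨ foldr-mono P (step≤step⁻ x a≤w) ⟩
      foldr step⁻ (step⁻ x w) P         ≡⟨ foldr-++ step⁻ w P [ x ] ⟨
      foldr step⁻ w (P ++ [ x ])        ≤⟨ bound ⟩
      candidate i                       ∎)
      where
      open ≤-Reasoning
      w = foldr (step a b p) 0ℚ (y ∷ L)

tabulate-∷ʳ : {A : Set} (m : ℕ) (f : Fin (suc m) → A) → tabulate f ≡ tabulate (f ∘ inject₁) ∷ʳ f (fromℕ m)
tabulate-∷ʳ N.zero    f = refl
tabulate-∷ʳ (suc m) f = cong (f zero ∷_) (tabulate-∷ʳ m (f ∘ suc))

observations : {n : ℕ} → Permutation′ n → List (Fin n)
observations {n} σ = map (σ ⟨$⟩ʳ_) (allFin n)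

observations-unique : {n : ℕ} (σ : Permutation′ n) → Unique (observations σ)
observations-unique {n} σ = map⁺ (Injection.injective (↔⇒↣ σ)) (allFin⁺ n)

module _ {m : ℕ} (σ : Permutation′ (suc m)) where

  last : Fin (suc m)
  last = σ ⟨$⟩ʳ fromℕ m

  front : List (Fin (suc m))
  front = tabulate ((σ ⟨$⟩ʳ_) ∘ inject₁)

  observations-front : observations σ ≡ front ∷ʳ last
  observations-front = trans (map-tabulate id (σ ⟨$⟩ʳ_)) (tabulate-∷ʳ m (σ ⟨$⟩ʳ_))

  front-complete : ∀ {z} → z ≢ last → z ∈ front
  front-complete {z} z≢last with ∈-++⁻ front (subst (z ∈_) observations-front z∈observations)
    where
    z∈observations : z ∈ observations σ
    z∈observations = subst (_∈ observations σ) (inverseʳ σ) (∈-map⁺ (σ ⟨$⟩ʳ_) (∈-allFin (σ ⟨$⟩ˡ z)))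
  ... | inj₁ z∈front    = z∈front
  ... | inj₂ (here z≡last) = ⊥-elim (z≢last z≡last)

  front-descending : (key : Fin (suc m) → ℚ) →
    (∀ k l → toℕ k N.< toℕ l → toℕ l N.< m → key (σ ⟨$⟩ʳ l) ≤ key (σ ⟨$⟩ʳ k)) →
    Descending key front
  front-descending key descending = tabulate⁺-< λ {k} {l} k<l →
    descending (inject₁ k) (inject₁ l)
      (subst₂ N._<_ (sym (toℕ-inject₁ k)) (sym (toℕ-inject₁ l)) k<l)
      (subst (N._< m) (sym (toℕ-inject₁ l)) (toℕ<n l))

  foldr-observations : {B : Set} (f : Fin (suc m) → B → B) (c : B) → foldr f c (observations σ) ≡ foldr f (f last c) front
  foldr-observations f c = trans (cong (foldr f c) observations-front) (foldr-∷ʳ f c last front)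

proposition2 : (m : ℕ) → (a b p : Fin (suc m) → ℚ) →
  (∀ j → a j ≤ b j) → (∀ j → 0ℚ ≤ p j) → (∀ j → p j ≤ 1ℚ) →
  (τ : Fin (suc m) → Permutation′ (suc m)) →
  (∀ i → τ i ⟨$⟩ʳ fromℕ m ≡ i) →
  (∀ i (k l : Fin (suc m)) → toℕ k N.< toℕ l → toℕ l N.< m →
    b (τ i ⟨$⟩ʳ l) ≤ b (τ i ⟨$⟩ʳ k)) →
  Σ (Fin (suc m)) (λ i → (σ : Permutation′ (suc m)) → V a b p σ ≤ V a b p (τ i))
proposition2 m a b p a≤b 0≤p p≤1 τ τ-last τ-descending = best , V≤V[best]
  where
  open TwoPoint a b p a≤b 0≤p p≤1
  open Walk (front ∘ τ) (λ i → front-descending (τ i) b (τ-descending i))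
            (λ i z≢i → front-complete (τ i) (λ z≡last → z≢i (trans z≡last (τ-last i))))

  candidate≡V : ∀ i → candidate i ≡ V a b p (τ i)
  candidate≡V i = sym (trans (foldr-observations (τ i) (step a b p) 0ℚ)
                             (cong (λ j → foldr (step a b p) (step a b p j 0ℚ) (front (τ i))) (τ-last i)))

  dominated : ∀ σ → Σ (Fin (suc m)) λ i → V a b p σ ≤ V a b p (τ i)
  dominated σ =
    let i , V≤candidate = walk [] (σ ⟨$⟩ʳ zero) (map (σ ⟨$⟩ʳ_) (tabulate suc)) (observations-unique σ)
    in i , ≤-trans V≤candidate (≤-reflexive (candidate≡V i))

  best : Fin (suc m)
  best = argmax (V a b p ∘ τ) zero (allFin (suc m))

  V≤V[best] : ∀ σ → V a b p σ ≤ V a b p (τ best)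
  V≤V[best] σ =
    let i , V≤V[τi] = dominated σ
    in ≤-trans V≤V[τi] (All.lookup (f[xs]≤f[argmax] {f = V a b p ∘ τ} zero (allFin (suc m))) (∈-allFin i))
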